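{- Let $m,n\geq 1$ be integers with $m+n\leq 5$, let $N=mn$ be the number of edges of the complete bipartite graph $K_{m,n}$, and let $\mathbb{K}$ be a field of characteristic zero. Then the algebra $A_{M(K_{m,n})}=\mathbb{K}[x_1,\ldots,x_N]/\mathrm{Ann}(F_{K_{m,n}})$ has the strong Lefschetz property, and $x_{1}+\cdots+x_{N}$ is a strong Lefschetz element.
   Context: For a connected graph $\Gamma$ with $N$ edges labelled $1,\dots,N$, assign the variable $x_e$ to edge $e$; the Kirchhoff polynomial is $F_\Gamma=\sum_{T}\prod_{e\in E(T)}x_e$, the sum over spanning trees $T$ of $\Gamma$. For a homogeneous $F\in\mathbb{K}[x_1,\ldots,x_N]$, $\mathrm{Ann}(F)=\{P\in\mathbb{K}[x_1,\ldots,x_N]: P(\partial/\partial x_1,\ldots,\partial/\partial x_N)F=0\}$, a homogeneous ideal; $A_{M(\Gamma)}=\mathbb{K}[x_1,\ldots,x_N]/\mathrm{Ann}(F_\Gamma)$ is a graded Artinian Gorenstein algebra. A graded Artinian algebra $A=\bigoplus_{k=0}^sA_k$ with $A_s\neq 0$ has the strong Lefschetz property if there is $L\in A_1$ such that multiplication by $L^{s-2k}$ is a bijection $A_k\to A_{s-k}$ for all $k\leq s/2$; such an $L$ is a strong Lefschetz element. -}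

module Defs where

open import Level using (Level; _⊔_) renaming (suc to lsuc)
open import Algebra.Bundles using (CommutativeRing)
open import Data.Bool using (Bool; true; false; _∧_; _∨_; if_then_else_)
open import Data.Nat as ℕ using (ℕ; zero; suc; _≡ᵇ_; _∸_; _<_)
open import Data.Nat.Combinatorics renaming (_P_ to _falling_)
open import Data.Fin as Fin using (Fin; _↑ˡ_; _↑ʳ_; remQuot)
open import Data.Fin.Properties using () renaming (_≟_ to _≟ᶠ_)
open import Data.Vec as Vec using (Vec; []; _∷_)
open import Data.List as List using (List; []; _∷_; _++_; concatMap)
open import Data.List.Relation.Unary.All using (All)
open import Data.Product using (_×_; _,_; proj₁; proj₂; ∃; ∃-syntax)
open import Relation.Nullary using (¬_; ⌊_⌋)
open import Relation.Binary.PropositionalEquality using (_≡_)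

record Field (c ℓ : Level) : Set (lsuc (c ⊔ ℓ)) where
  field
    commutativeRing : CommutativeRing c ℓ
  open CommutativeRing commutativeRing public
  field
    1≉0     : ¬ (1# ≈ 0#)
    inverse : ∀ x → ¬ (x ≈ 0#) → ∃[ y ] (x * y ≈ 1#)

  fromℕ : ℕ → Carrier
  fromℕ zero    = 0#
  fromℕ (suc n) = 1# + fromℕ n

CharZero : ∀ {c ℓ} → Field c ℓ → Set ℓ
CharZero K = ∀ n → ¬ (fromℕ (suc n) ≈ 0#)
  where open Field K

record Graph : Set where
  field
    V    : ℕ
    E    : ℕ
    ends : Fin E → Fin V × Fin V

-- The complete bipartite graph K_{m,n}: vertices 0..m-1 on one side and
-- m..m+n-1 on the other; the edge joining i and j gets label i*n + j
-- (so the edges are labelled by Fin (m * n)).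
K[_,_] : ℕ → ℕ → Graph
K[ m , n ] = record
  { V    = m ℕ.+ n
  ; E    = m ℕ.* n
  ; ends = λ e → let ij = remQuot n e in (proj₁ ij ↑ˡ n , m ↑ʳ proj₂ ij)
  }

_==ᶠ_ : ∀ {k} → Fin k → Fin k → Bool
i ==ᶠ j = ⌊ i ≟ᶠ j ⌋

anyFin : ∀ k → (Fin k → Bool) → Bool
anyFin zero    f = false
anyFin (suc k) f = f Fin.zero ∨ anyFin k (λ i → f (Fin.suc i))

allFin : ∀ k → (Fin k → Bool) → Bool
allFin zero    f = true
allFin (suc k) f = f Fin.zero ∧ allFin k (λ i → f (Fin.suc i))

countTrue : ∀ {k} → Vec Bool k → ℕ
countTrue []          = 0
countTrue (true ∷ b)  = suc (countTrue b)
countTrue (false ∷ b) = countTrue b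

subsets : ∀ k → List (Vec Bool k)
subsets zero    = [] ∷ []
subsets (suc k) = List.map (true ∷_) (subsets k) ++ List.map (false ∷_) (subsets k)

iterate : ∀ {A : Set} → ℕ → (A → A) → A → A
iterate zero    f a = a
iterate (suc k) f a = f (iterate k f a)

-- one step of the reachability closure in the spanning subgraph with edge
-- set T: add every vertex joined by an edge of T to an already reached one
step : ∀ {V E} → (Fin E → Fin V × Fin V) → Vec Bool E → (Fin V → Bool) → (Fin V → Bool)
step {V} {E} ends T R v = R v ∨ anyFin E (λ e →
  Vec.lookup T e ∧
    ((R (proj₁ (ends e)) ∧ (proj₂ (ends e) ==ᶠ v)) ∨
     (R (proj₂ (ends e)) ∧ (proj₁ (ends e) ==ᶠ v))))

-- the spanning subgraph with edge set T is connected: starting from vertex 0,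
-- V rounds of the closure reach every vertex
connected′ : ∀ V {E} → (Fin E → Fin V × Fin V) → Vec Bool E → Bool
connected′ zero    ends T = true
connected′ (suc V) ends T =
  allFin (suc V) (iterate (suc V) (step ends T) (λ v → v ==ᶠ Fin.zero))

-- T ⊆ E(G) is (the edge set of) a spanning tree: the spanning subgraph
-- (V(G), T) is connected and has |V(G)| - 1 edges (equivalently: is a
-- connected acyclic spanning subgraph)
isSpanningTree : (G : Graph) → Vec Bool (Graph.E G) → Bool
isSpanningTree G T =
  connected′ (Graph.V G) (Graph.ends G) T ∧ (countTrue T ≡ᵇ (Graph.V G ∸ 1))

filterᵇ : ∀ {A : Set} → (A → Bool) → List A → List A
filterᵇ p []       = []
filterᵇ p (x ∷ xs) = if p x then x ∷ filterᵇ p xs else filterᵇ p xs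

-- A monomial is its exponent vector; a polynomial is a finite formal sum of
-- terms (coefficient, monomial); two polynomials are equal when all their
-- coefficients agree (so "P = 0" means every coefficient is ≈ 0).

module Poly {c ℓ} (K : Field c ℓ) where
  open Field K

  Mon : ℕ → Set
  Mon N = Vec ℕ N

  Polynomial : ℕ → Set c
  Polynomial N = List (Carrier × Mon N)

  deg : ∀ {N} → Mon N → ℕ
  deg = Vec.sum

  _==ᵐ_ : ∀ {N} → Mon N → Mon N → Bool
  []       ==ᵐ []       = true
  (a ∷ as) ==ᵐ (b ∷ bs) = (a ≡ᵇ b) ∧ (as ==ᵐ bs)

  coeff : ∀ {N} → Polynomial N → Mon N → Carrier
  coeff []            α = 0#
  coeff ((a , β) ∷ P) α = if β ==ᵐ α then a + coeff P α else coeff P α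

  IsZero : ∀ {N} → Polynomial N → Set ℓ
  IsZero P = ∀ α → coeff P α ≈ 0#

  Homogeneous : ∀ {N} → ℕ → Polynomial N → Set c
  Homogeneous k P = All (λ t → deg (proj₂ t) ≡ k) P

  _⊕_ : ∀ {N} → Polynomial N → Polynomial N → Polynomial N
  P ⊕ Q = P ++ Q

  ⊝_ : ∀ {N} → Polynomial N → Polynomial N
  ⊝ P = List.map (λ t → (- proj₁ t , proj₂ t)) P

  _⊖_ : ∀ {N} → Polynomial N → Polynomial N → Polynomial N
  P ⊖ Q = P ⊕ (⊝ Q)

  _⊗_ : ∀ {N} → Polynomial N → Polynomial N → Polynomial N
  P ⊗ Q = concatMap (λ s → List.map (λ t →
            (proj₁ s * proj₁ t , Vec.zipWith ℕ._+_ (proj₂ s) (proj₂ t))) Q) P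

  one : ∀ {N} → Polynomial N
  one {N} = (1# , Vec.replicate N 0) ∷ []

  _^_ : ∀ {N} → Polynomial N → ℕ → Polynomial N
  L ^ zero  = one
  L ^ suc k = L ⊗ (L ^ k)

  var : ∀ {N} → Fin N → Polynomial N
  var {N} i = (1# , Vec.tabulate (λ j → if i ==ᶠ j then 1 else 0)) ∷ []

  sumVars : ∀ N → Polynomial N
  sumVars N = concatMap var (List.allFin N)

  -- ∂^α (x^β) = (∏_i β_i!/(β_i-α_i)!) x^(β-α)   (which is 0 unless α ≤ β;
  -- n P k = n!/(n-k)! for k ≤ n and 0 otherwise)
  -- P(∂/∂x_1, …, ∂/∂x_N) F :
  applyDiff : ∀ {N} → Polynomial N → Polynomial N → Polynomial N
  applyDiff P F = concatMap (λ s → List.map (λ t →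
      ( proj₁ s * proj₁ t * fromℕ (Vec.foldr (λ _ → ℕ) ℕ._*_ 1 (Vec.zipWith _falling_ (proj₂ t) (proj₂ s)))
      , Vec.zipWith _∸_ (proj₂ t) (proj₂ s))) F) P

  InAnn : ∀ {N} → Polynomial N → Polynomial N → Set ℓ
  InAnn F P = IsZero (applyDiff P F)

  -- Graded pieces of A = K[x]/Ann(F) (Ann(F) is homogeneous, so
  -- A_k = K[x]_k / Ann(F)_k).
  -- A_k = 0 :
  PieceZero : ∀ {N} → Polynomial N → ℕ → Set (c ⊔ ℓ)
  PieceZero F k = ∀ P → Homogeneous k P → InAnn F P

  TopDegree : ∀ {N} → Polynomial N → ℕ → Set (c ⊔ ℓ)
  TopDegree F s = ¬ PieceZero F s × (∀ k → s < k → PieceZero F k)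

  MulBijective : ∀ {N} → Polynomial N → Polynomial N → ℕ → ℕ → Set (c ⊔ ℓ)
  MulBijective F M k k′ =
      (∀ P → Homogeneous k P → InAnn F (M ⊗ P) → InAnn F P)
    × (∀ Q → Homogeneous k′ Q → ∃[ P ] (Homogeneous k P × InAnn F ((M ⊗ P) ⊖ Q)))

  IsStrongLefschetzElement : ∀ {N} → Polynomial N → Polynomial N → Set (c ⊔ ℓ)
  IsStrongLefschetzElement F L =
    Homogeneous 1 L ×
    ∃[ s ] (TopDegree F s ×
            (∀ k → k ℕ.+ k ℕ.≤ s → MulBijective F (L ^ (s ∸ (k ℕ.+ k))) k (s ∸ k)))

  HasStrongLefschetzProperty : ∀ {N} → Polynomial N → Set (c ⊔ ℓ)
  HasStrongLefschetzProperty {N} F = ∃[ L ] IsStrongLefschetzElement F L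

  subsetMon : ∀ {k} → Vec Bool k → Mon k
  subsetMon = Vec.map (λ b → if b then 1 else 0)

  kirchhoff : (G : Graph) → Polynomial (Graph.E G)
  kirchhoff G = List.map (λ T → (1# , subsetMon T))
                  (filterᵇ (isSpanningTree G) (subsets (Graph.E G)))

-- The coefficient of x^γ in P(∂)F is a linear functional of P whose matrix consists of
-- natural numbers (contractions of F), and as F is homogeneous of degree s only degrees
-- complementary to that of P matter.  For k ≤ s/2, multiplication by L^(s-2k) : A_k → A_(s-k)
-- is therefore injective as soon as each functional P ↦ [x^γ] P(∂)F with deg γ = s - k is a
-- combination of the functionals P ↦ [x^δ] (L^(s-2k) P)(∂)F, and surjective as soon as each
-- x^β with deg β = s - k is, modulo Ann(F), L^(s-2k) times a form of degree k.  For K_{m,n}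
-- with m + n ≤ 5 both facts are witnessed by explicit rational solutions of these linear
-- systems, stored as integer tables over a common denominator 1 + scale and checked by
-- evaluation; characteristic zero makes that denominator and the socle coefficient invertible.

module Submission where

open import Defs
open import Data.Nat using (ℕ; _+_; _*_; _≤_)
open import Data.Product using (_×_)

open import Level using (_⊔_)
open import Data.Bool using (true; false; T; if_then_else_)
open import Data.Nat as ℕ using (zero; suc; _∸_; _<_; _≡ᵇ_; _≟_; _≤?_; s≤s)
import Data.Nat.Properties as ℕₚ
open import Data.Nat.Combinatorics using (k>n⇒nPk≡0) renaming (_P_ to _falling_)
open import Data.Fin as Fin using (Fin)
open import Data.Vec as Vec using (Vec; []; _∷_)
open import Data.Vec.Properties using (tabulate-cong)
open import Data.List as List using (List; []; _∷_; _++_; concatMap; upTo)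
open import Data.Nat.ListAction using (sum)
open import Data.List.Relation.Unary.All as All using (All; []; _∷_; all?)
open import Data.List.Relation.Unary.All.Properties using (++⁺; concat⁺; map⁺)
open import Data.List.Relation.Unary.Any using (Any; here; any?)
open import Data.List.Membership.Propositional using (_∈_; find)
open import Data.List.Membership.Propositional.Properties
  using (∈-map⁺; ∈-++⁺ˡ; ∈-++⁺ʳ; ∈-upTo⁺)
open import Data.Product using (_,_; proj₁; proj₂; ∃-syntax; map₂)
open import Data.Sum using (_⊎_; inj₁; inj₂)
open import Relation.Nullary using (¬_; Dec; yes; no; ¬?; contradiction)
open import Relation.Nullary.Decidable using (True; toWitness; _×-dec_; _→-dec_)
open import Function using (_∘_)
open import Relation.Binary.PropositionalEquality
  using (_≡_; _≢_; refl; sym; trans; cong; cong₂; subst)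
open import Algebra.Properties.CommutativeSemigroup ℕₚ.+-commutativeSemigroup using ()
  renaming (interchange to +-interchange)

monomials : ∀ N → ℕ → List (Vec ℕ N)
monomials zero    zero    = [] ∷ []
monomials zero    (suc k) = []
monomials (suc N) zero    = List.map (0 ∷_) (monomials N zero)
monomials (suc N) (suc k) =
  List.map (0 ∷_) (monomials N (suc k)) ++ List.map incrementHead (monomials (suc N) k)
  where
  incrementHead : Vec ℕ (suc N) → Vec ℕ (suc N)
  incrementHead (a ∷ α) = suc a ∷ α

∈-monomials : ∀ {N} (α : Vec ℕ N) k → Vec.sum α ≡ k → α ∈ monomials N k
∈-monomials []            zero    refl = here refl
∈-monomials (zero ∷ α)    zero    e    = ∈-map⁺ (0 ∷_) (∈-monomials α zero e)
∈-monomials (zero ∷ α)    (suc k) e    = ∈-++⁺ˡ (∈-map⁺ (0 ∷_) (∈-monomials α (suc k) e))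
∈-monomials (suc a ∷ α)   (suc k) e    =
  ∈-++⁺ʳ _ (∈-map⁺ _ (∈-monomials (a ∷ α) k (ℕₚ.suc-injective e)))

sum-zipWith-+ : ∀ {N} (μ α : Vec ℕ N) → Vec.sum (Vec.zipWith _+_ μ α) ≡ Vec.sum μ + Vec.sum α
sum-zipWith-+ []      []      = refl
sum-zipWith-+ (m ∷ μ) (a ∷ α) =
  trans (cong (m + a +_) (sum-zipWith-+ μ α)) (+-interchange m a (Vec.sum μ) (Vec.sum α))

derivCoeff : ∀ {N} → Vec ℕ N → Vec ℕ N → ℕ
derivCoeff β α = Vec.foldr (λ _ → ℕ) ℕ._*_ 1 (Vec.zipWith _falling_ β α)

derivCoeff-degree : ∀ {N} (β α : Vec ℕ N) →
  derivCoeff β α ≡ 0 ⊎ Vec.sum (Vec.zipWith _∸_ β α) + Vec.sum α ≡ Vec.sum β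
derivCoeff-degree []      []      = inj₂ refl
derivCoeff-degree (b ∷ β) (a ∷ α) with a ≤? b | derivCoeff-degree β α
... | no  a≰b | _           = inj₁ (cong (_* derivCoeff β α) (k>n⇒nPk≡0 (ℕₚ.≰⇒> a≰b)))
... | yes _   | inj₁ vanish = inj₁ (trans (cong ((b falling a) *_) vanish) (ℕₚ.*-zeroʳ (b falling a)))
... | yes a≤b | inj₂ β-deg  = inj₂ (trans
  (+-interchange (b ∸ a) (Vec.sum (Vec.zipWith _∸_ β α)) a (Vec.sum α))
  (cong₂ _+_ (ℕₚ.m∸n+n≡m a≤b) β-deg))

Combination : ℕ → Set
Combination N = List (ℕ × Vec ℕ N)

combine : ∀ {N} → Combination N → (Vec ℕ N → ℕ) → ℕ
combine []            f = 0
combine ((x , δ) ∷ X) f = x * f δ + combine X f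

-- In certificates a monomial x^α (all exponents below 10) is written as the
-- decimal number with digits α₀ α₁ … α_{N-1}.
decimal : ∀ {N} → Vec ℕ N → ℕ
decimal = Vec.foldl (λ _ → ℕ) (λ code a → 10 * code + a) 0

fromDecimal : ∀ N → ℕ → Vec ℕ N
fromDecimal zero    _    = []
fromDecimal (suc N) code = fromDecimal N (code ℕ./ 10) Vec.∷ʳ (code ℕ.% 10)

-- A row stores the integer combination Σ cᵢ x^δᵢ attached to the monomial
-- coded by its key, split into positive and negative parts; monomials without
-- a row get the empty combination.
record Row : Set where
  constructor row
  field
    key      : ℕ
    positive : List (ℕ × ℕ)
    negative : List (ℕ × ℕ)

record DegreeCertificate : Set where
  field
    scale : ℕ
    rows  : List Row

  rowAt : ∀ {N} → Vec ℕ N → Combination N × Combination N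
  rowAt {N} γ = go rows
    where
    decode : List (ℕ × ℕ) → Combination N
    decode = List.map (map₂ (fromDecimal N))
    go : List Row → Combination N × Combination N
    go []                  = [] , []
    go (row κ pos neg ∷ ρ) = if decimal γ ≡ᵇ κ then (decode pos , decode neg) else go ρ

  positiveAt negativeAt : ∀ {N} → Vec ℕ N → Combination N
  positiveAt γ = proj₁ (rowAt γ)
  negativeAt γ = proj₂ (rowAt γ)

record LefschetzCertificate : Set where
  field
    socleDegree : ℕ
    atDegree    : ℕ → DegreeCertificate

open DegreeCertificate
open LefschetzCertificate

module _ {c ℓ} (K : Field c ℓ) where
  open Field K hiding (zero) renaming
    (_+_ to _+ᴷ_; _*_ to _*ᴷ_; refl to ≈-refl; sym to ≈-sym; trans to ≈-trans)
  open Poly K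
  open import Relation.Binary.Reasoning.Setoid setoid
  open import Algebra.Properties.Ring ring using (-‿distribˡ-*)
  open import Algebra.Properties.AbelianGroup +-abelianGroup using (⁻¹-∙-comm)
  open import Algebra.Properties.CommutativeSemigroup +-commutativeSemigroup using ()
    renaming (interchange to +ᴷ-interchange)
  open import Algebra.Properties.CommutativeSemigroup *-commutativeSemigroup using (x∙yz≈y∙xz)
  open import Algebra.Properties.Group +-group using (ε⁻¹≈ε)

  fromℕ-+ : ∀ m n → fromℕ (m + n) ≈ fromℕ m +ᴷ fromℕ n
  fromℕ-+ zero    n = ≈-sym (+-identityˡ _)
  fromℕ-+ (suc m) n = ≈-trans (+-congˡ (fromℕ-+ m n)) (≈-sym (+-assoc 1# _ _))

  fromℕ-* : ∀ m n → fromℕ (m * n) ≈ fromℕ m *ᴷ fromℕ n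
  fromℕ-* zero    n = ≈-sym (zeroˡ _)
  fromℕ-* (suc m) n = begin
    fromℕ (n + m * n)              ≈⟨ fromℕ-+ n (m * n) ⟩
    fromℕ n +ᴷ fromℕ (m * n)        ≈⟨ +-cong (≈-sym (*-identityˡ _)) (fromℕ-* m n) ⟩
    1# *ᴷ fromℕ n +ᴷ fromℕ m *ᴷ fromℕ n ≈⟨ distribʳ _ 1# _ ⟨
    (1# +ᴷ fromℕ m) *ᴷ fromℕ n      ∎

  fromℕ-nonzero : CharZero K → ∀ {n} → n ≢ 0 → ¬ (fromℕ n ≈ 0#)
  fromℕ-nonzero charZero {zero}  n≢0 = contradiction refl n≢0
  fromℕ-nonzero charZero {suc n} _   = charZero n

  x≉0∧x*y≈0⇒y≈0 : ∀ {x y} → ¬ (x ≈ 0#) → x *ᴷ y ≈ 0# → y ≈ 0#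
  x≉0∧x*y≈0⇒y≈0 {x} {y} x≉0 xy≈0 with inverse x x≉0
  ... | x⁻¹ , xx⁻¹≈1 = begin
    y                  ≈⟨ *-identityˡ y ⟨
    1# *ᴷ y            ≈⟨ *-congʳ (≈-trans (*-comm x⁻¹ x) xx⁻¹≈1) ⟨
    (x⁻¹ *ᴷ x) *ᴷ y    ≈⟨ *-assoc x⁻¹ x y ⟩
    x⁻¹ *ᴷ (x *ᴷ y)    ≈⟨ *-congˡ xy≈0 ⟩
    x⁻¹ *ᴷ 0#          ≈⟨ zeroʳ x⁻¹ ⟩
    0#                 ∎

  ==ᵐ⇒≡ : ∀ {N} (α β : Mon N) → T (α ==ᵐ β) → α ≡ β
  ==ᵐ⇒≡ []      []      _ = refl
  ==ᵐ⇒≡ (a ∷ α) (b ∷ β) eq with a ≡ᵇ b in a≡ᵇb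
  ... | true = cong₂ _∷_ (ℕₚ.≡ᵇ⇒≡ a b (subst T (sym a≡ᵇb) _)) (==ᵐ⇒≡ α β eq)

  exponents : ∀ {N} → Polynomial N → List (Mon N)
  exponents = List.map proj₂

  UnitCoefficients : ∀ {N} → Polynomial N → Set (c ⊔ ℓ)
  UnitCoefficients = All (λ t → proj₁ t ≈ 1#)

  -- the coefficient of x^γ in ∂^α (Σ_{β ∈ βs} x^β)
  contraction : ∀ {N} → List (Mon N) → Mon N → Mon N → ℕ
  contraction []       α γ = 0
  contraction (β ∷ βs) α γ =
    (if Vec.zipWith _∸_ β α ==ᵐ γ then derivCoeff β α else 0) + contraction βs α γ

  -- the coefficient of x^γ in (x^α Σ_{μ ∈ μs} x^μ)(∂) (Σ_{β ∈ βs} x^β)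
  contractionBy : ∀ {N} → List (Mon N) → List (Mon N) → Mon N → Mon N → ℕ
  contractionBy μs βs α γ = sum (List.map (λ μ → contraction βs (Vec.zipWith _+_ μ α) γ) μs)

  contraction-offDegree : ∀ {N s} (βs : List (Mon N)) α γ → All (λ β → deg β ≡ s) βs →
                          deg γ + deg α ≢ s → contraction βs α γ ≡ 0
  contraction-offDegree []       α γ []               off = refl
  contraction-offDegree (β ∷ βs) α γ (β-deg ∷ βs-deg) off =
    cong₂ _+_ term (contraction-offDegree βs α γ βs-deg off)
    where
    term : (if Vec.zipWith _∸_ β α ==ᵐ γ then derivCoeff β α else 0) ≡ 0
    term with Vec.zipWith _∸_ β α ==ᵐ γ in eq
    ... | false = refl
    ... | true with derivCoeff-degree β α
    ...   | inj₁ vanishes = vanishes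
    ...   | inj₂ degree   = contradiction (subst (λ δ → deg δ + deg α ≡ _) difference≡γ (trans degree β-deg)) off
      where
      difference≡γ : Vec.zipWith _∸_ β α ≡ γ
      difference≡γ = ==ᵐ⇒≡ (Vec.zipWith _∸_ β α) γ (subst T (sym eq) _)

  pairing : ∀ {N} → Polynomial N → (Mon N → ℕ) → Carrier
  pairing []            φ = 0#
  pairing ((a , α) ∷ P) φ = a *ᴷ fromℕ (φ α) +ᴷ pairing P φ

  pairing-++ : ∀ {N} (P Q : Polynomial N) φ → pairing (P ++ Q) φ ≈ pairing P φ +ᴷ pairing Q φ
  pairing-++ []      Q φ = ≈-sym (+-identityˡ _)
  pairing-++ (t ∷ P) Q φ = ≈-trans (+-congˡ (pairing-++ P Q φ)) (≈-sym (+-assoc _ _ _))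

  pairing-+ : ∀ {N} (P : Polynomial N) φ ψ →
              pairing P (λ α → φ α + ψ α) ≈ pairing P φ +ᴷ pairing P ψ
  pairing-+ []            φ ψ = ≈-sym (+-identityˡ 0#)
  pairing-+ ((a , α) ∷ P) φ ψ = begin
    a *ᴷ fromℕ (φ α + ψ α) +ᴷ pairing P (λ β → φ β + ψ β)
      ≈⟨ +-cong (≈-trans (*-congˡ (fromℕ-+ (φ α) (ψ α))) (distribˡ a _ _)) (pairing-+ P φ ψ) ⟩
    (a *ᴷ fromℕ (φ α) +ᴷ a *ᴷ fromℕ (ψ α)) +ᴷ (pairing P φ +ᴷ pairing P ψ)
      ≈⟨ +ᴷ-interchange _ _ _ _ ⟩
    (a *ᴷ fromℕ (φ α) +ᴷ pairing P φ) +ᴷ (a *ᴷ fromℕ (ψ α) +ᴷ pairing P ψ) ∎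

  pairing-scale : ∀ {N} (P : Polynomial N) x φ → pairing P (λ α → x * φ α) ≈ fromℕ x *ᴷ pairing P φ
  pairing-scale []            x φ = ≈-sym (zeroʳ _)
  pairing-scale ((a , α) ∷ P) x φ = begin
    a *ᴷ fromℕ (x * φ α) +ᴷ pairing P (λ β → x * φ β)
      ≈⟨ +-cong (*-congˡ (fromℕ-* x (φ α))) (pairing-scale P x φ) ⟩
    a *ᴷ (fromℕ x *ᴷ fromℕ (φ α)) +ᴷ fromℕ x *ᴷ pairing P φ
      ≈⟨ +-congʳ (x∙yz≈y∙xz a (fromℕ x) _) ⟩
    fromℕ x *ᴷ (a *ᴷ fromℕ (φ α)) +ᴷ fromℕ x *ᴷ pairing P φ
      ≈⟨ distribˡ (fromℕ x) _ _ ⟨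
    fromℕ x *ᴷ (a *ᴷ fromℕ (φ α) +ᴷ pairing P φ) ∎

  pairing-cong : ∀ {N} (P : Polynomial N) {φ ψ} →
                 All (λ t → φ (proj₂ t) ≡ ψ (proj₂ t)) P → pairing P φ ≈ pairing P ψ
  pairing-cong []      []       = ≈-refl
  pairing-cong (t ∷ P) (e ∷ es) = +-cong (*-congˡ (reflexive (cong fromℕ e))) (pairing-cong P es)

  pairing-vanishes : ∀ {N} (P : Polynomial N) {φ} → All (λ t → φ (proj₂ t) ≡ 0) P → pairing P φ ≈ 0#
  pairing-vanishes []      []       = ≈-refl
  pairing-vanishes (t ∷ P) (e ∷ es) = ≈-trans
    (+-cong (≈-trans (*-congˡ (reflexive (cong fromℕ e))) (zeroʳ _)) (pairing-vanishes P es))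
    (+-identityʳ 0#)

  pairing-⊝ : ∀ {N} (P : Polynomial N) φ → pairing (⊝ P) φ ≈ - pairing P φ
  pairing-⊝ []            φ = ≈-sym ε⁻¹≈ε
  pairing-⊝ ((a , α) ∷ P) φ =
    ≈-trans (+-cong (≈-sym (-‿distribˡ-* a _)) (pairing-⊝ P φ)) (⁻¹-∙-comm _ _)

  pairing-combine-vanishes : ∀ {N} (P : Polynomial N) (E : Mon N → Mon N → ℕ) (X : Combination N) →
    (∀ δ → pairing P (λ α → E α δ) ≈ 0#) → pairing P (λ α → combine X (E α)) ≈ 0#
  pairing-combine-vanishes P E []            E-vanishes = pairing-vanishes P (All.universal (λ _ → refl) P)
  pairing-combine-vanishes P E ((x , δ) ∷ X) E-vanishes = begin
    pairing P (λ α → x * E α δ + combine X (E α))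
      ≈⟨ pairing-+ P (λ α → x * E α δ) (λ α → combine X (E α)) ⟩
    pairing P (λ α → x * E α δ) +ᴷ pairing P (λ α → combine X (E α))
      ≈⟨ +-cong (pairing-scale P x (λ α → E α δ)) (pairing-combine-vanishes P E X E-vanishes) ⟩
    fromℕ x *ᴷ pairing P (λ α → E α δ) +ᴷ 0#
      ≈⟨ +-identityʳ _ ⟩
    fromℕ x *ᴷ pairing P (λ α → E α δ)
      ≈⟨ *-congˡ (E-vanishes δ) ⟩
    fromℕ x *ᴷ 0#
      ≈⟨ zeroʳ _ ⟩
    0# ∎
  coeff-++ : ∀ {N} (P Q : Polynomial N) γ → coeff (P ++ Q) γ ≈ coeff P γ +ᴷ coeff Q γ
  coeff-++ []            Q γ = ≈-sym (+-identityˡ _)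
  coeff-++ ((a , α) ∷ P) Q γ with α ==ᵐ γ
  ... | true  = ≈-trans (+-congˡ (coeff-++ P Q γ)) (≈-sym (+-assoc _ _ _))
  ... | false = coeff-++ P Q γ

  derivativeTerm : ∀ {N} → Carrier × Mon N → Carrier × Mon N → Carrier × Mon N
  derivativeTerm (a , α) (b , β) = a *ᴷ b *ᴷ fromℕ (derivCoeff β α) , Vec.zipWith _∸_ β α

  coeff-derivative : ∀ {N} a α (F : Polynomial N) γ → UnitCoefficients F →
    coeff (List.map (derivativeTerm (a , α)) F) γ ≈ a *ᴷ fromℕ (contraction (exponents F) α γ)
  coeff-derivative a α []            γ []             = ≈-sym (zeroʳ a)
  coeff-derivative a α ((b , β) ∷ F) γ (b≈1 ∷ unitF) with Vec.zipWith _∸_ β α ==ᵐ γ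
  ... | false = coeff-derivative a α F γ unitF
  ... | true  = begin
    a *ᴷ b *ᴷ fromℕ w +ᴷ coeff (List.map (derivativeTerm (a , α)) F) γ
      ≈⟨ +-cong (*-congʳ (≈-trans (*-congˡ b≈1) (*-identityʳ a))) (coeff-derivative a α F γ unitF) ⟩
    a *ᴷ fromℕ w +ᴷ a *ᴷ fromℕ (contraction (exponents F) α γ)
      ≈⟨ distribˡ a _ _ ⟨
    a *ᴷ (fromℕ w +ᴷ fromℕ (contraction (exponents F) α γ))
      ≈⟨ *-congˡ (fromℕ-+ w _) ⟨
    a *ᴷ fromℕ (w + contraction (exponents F) α γ) ∎
    where
    w : ℕ
    w = derivCoeff β α

  coeff-applyDiff : ∀ {N} (P F : Polynomial N) γ → UnitCoefficients F →
    coeff (applyDiff P F) γ ≈ pairing P (λ α → contraction (exponents F) α γ)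
  coeff-applyDiff []            F γ unitF = ≈-refl
  coeff-applyDiff ((a , α) ∷ P) F γ unitF = ≈-trans
    (coeff-++ (List.map (derivativeTerm (a , α)) F) (applyDiff P F) γ)
    (+-cong (coeff-derivative a α F γ unitF) (coeff-applyDiff P F γ unitF))

  pairing-⊗ : ∀ {N} (M P : Polynomial N) φ → UnitCoefficients M →
    pairing (M ⊗ P) φ ≈ pairing P (λ α → sum (List.map (λ μ → φ (Vec.zipWith _+_ μ α)) (exponents M)))
  pairing-⊗ []            P φ []            = ≈-sym (pairing-vanishes P (All.universal (λ _ → refl) P))
  pairing-⊗ {N} ((b , μ) ∷ M) P φ (b≈1 ∷ unitM) = begin
    pairing (bx^μ· P ++ M ⊗ P) φ                          ≈⟨ pairing-++ (bx^μ· P) (M ⊗ P) φ ⟩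
    pairing (bx^μ· P) φ +ᴷ pairing (M ⊗ P) φ             ≈⟨ +-cong (pairing-shift P) (pairing-⊗ M P φ unitM) ⟩
    pairing P (λ α → φ (Vec.zipWith _+_ μ α)) +ᴷ pairing P (shifted M)
      ≈⟨ pairing-+ P (λ α → φ (Vec.zipWith _+_ μ α)) (shifted M) ⟨
    pairing P (shifted ((b , μ) ∷ M)) ∎
    where
    bx^μ· : Polynomial N → Polynomial N
    bx^μ· = List.map (λ t → b *ᴷ proj₁ t , Vec.zipWith _+_ μ (proj₂ t))
    shifted : Polynomial N → Mon N → ℕ
    shifted M α = sum (List.map (λ μ → φ (Vec.zipWith _+_ μ α)) (exponents M))
    pairing-shift : ∀ Q → pairing (bx^μ· Q) φ ≈ pairing Q (λ α → φ (Vec.zipWith _+_ μ α))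
    pairing-shift []            = ≈-refl
    pairing-shift ((a , α) ∷ Q) =
      +-cong (*-congʳ (≈-trans (*-congʳ b≈1) (*-identityˡ a))) (pairing-shift Q)

  coeff-applyDiff-⊗ : ∀ {N} (M P F : Polynomial N) γ → UnitCoefficients M → UnitCoefficients F →
    coeff (applyDiff (M ⊗ P) F) γ ≈ pairing P (λ α → contractionBy (exponents M) (exponents F) α γ)
  coeff-applyDiff-⊗ M P F γ unitM unitF =
    ≈-trans (coeff-applyDiff (M ⊗ P) F γ unitF) (pairing-⊗ M P (λ β → contraction (exponents F) β γ) unitM)

  UnitCoefficients-⊗ : ∀ {N} {M P : Polynomial N} → UnitCoefficients M → UnitCoefficients P →
                       UnitCoefficients (M ⊗ P)
  UnitCoefficients-⊗ unitM unitP = concat⁺ (map⁺ (All.map (λ b≈1 → map⁺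
    (All.map (λ a≈1 → ≈-trans (*-cong b≈1 a≈1) (*-identityˡ 1#)) unitP)) unitM))

  UnitCoefficients-sumVars^ : ∀ N j → UnitCoefficients (sumVars N ^ j)
  UnitCoefficients-sumVars^ N zero    = ≈-refl ∷ []
  UnitCoefficients-sumVars^ N (suc j) = UnitCoefficients-⊗
    (concat⁺ (map⁺ (All.universal (λ _ → ≈-refl ∷ []) (List.allFin N))))
    (UnitCoefficients-sumVars^ N j)

  UnitCoefficients-kirchhoff : ∀ G → UnitCoefficients (kirchhoff G)
  UnitCoefficients-kirchhoff G = map⁺ (All.universal (λ _ → ≈-refl) _)

  Homogeneous-⊗ : ∀ {N a b} {M P : Polynomial N} → Homogeneous a M → Homogeneous b P →
                  Homogeneous (a + b) (M ⊗ P)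
  Homogeneous-⊗ homM homP = concat⁺ (map⁺ (All.map (λ {s} μ-deg → map⁺
    (All.map (λ {t} α-deg → trans (sum-zipWith-+ (proj₂ s) (proj₂ t)) (cong₂ _+_ μ-deg α-deg)) homP)) homM))

  Homogeneous-sumVars : ∀ N → Homogeneous 1 (sumVars N)
  Homogeneous-sumVars N = concat⁺ (map⁺ (All.universal (λ i → sum-indicator i ∷ []) (List.allFin N)))
    where
    sum-zeros : ∀ n → Vec.sum (Vec.tabulate {n = n} (λ _ → 0)) ≡ 0
    sum-zeros zero    = refl
    sum-zeros (suc n) = sum-zeros n
    sum-indicator : ∀ {n} (i : Fin n) → Vec.sum (Vec.tabulate (λ j → if i ==ᶠ j then 1 else 0)) ≡ 1
    sum-indicator {suc n} Fin.zero    = cong suc (sum-zeros n)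
    sum-indicator {suc n} (Fin.suc i) = trans
      (cong Vec.sum (tabulate-cong (λ j → cong (if_then 1 else 0) (suc==ᶠsuc i j))))
      (sum-indicator i)
      where
      suc==ᶠsuc : ∀ {n} (i j : Fin n) → (Fin.suc i ==ᶠ Fin.suc j) ≡ (i ==ᶠ j)
      suc==ᶠsuc i j with i Fin.≟ j
      ... | yes _ = refl
      ... | no  _ = refl

  Homogeneous-sumVars^ : ∀ N j → Homogeneous j (sumVars N ^ j)
  Homogeneous-sumVars^ N zero    = sum-replicate-0 N ∷ []
    where
    sum-replicate-0 : ∀ n → Vec.sum (Vec.replicate n 0) ≡ 0
    sum-replicate-0 zero    = refl
    sum-replicate-0 (suc n) = sum-replicate-0 n
  Homogeneous-sumVars^ N (suc j) = Homogeneous-⊗ (Homogeneous-sumVars N) (Homogeneous-sumVars^ N j)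

  -- For deg α = r the derivative ∂^α F of a form of degree s only has terms of degree s ∸ r.
  InAnn-byDegree : ∀ {N s r} {F R : Polynomial N} → UnitCoefficients F → Homogeneous s F → Homogeneous r R →
    (∀ γ → deg γ + r ≡ s → coeff (applyDiff R F) γ ≈ 0#) → InAnn F R
  InAnn-byDegree {N} {s} {r} {F} {R} unitF homF homR complementary γ with deg γ + r ≟ s
  ... | yes γ+r≡s = complementary γ γ+r≡s
  ... | no  γ+r≢s = ≈-trans (coeff-applyDiff R F γ unitF)
    (pairing-vanishes R {λ α → contraction (exponents F) α γ} (All.map (λ {t} → vanishes {t}) homR))
    where
    vanishes : ∀ {t : Carrier × Mon N} → deg (proj₂ t) ≡ r → contraction (exponents F) (proj₂ t) γ ≡ 0
    vanishes {t} α-deg = contraction-offDegree (exponents F) (proj₂ t) γ (map⁺ homF)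
      (γ+r≢s ∘ subst (λ d → deg γ + d ≡ s) α-deg)

  -- Row γ writes (1 + scale) · (P ↦ coefficient of x^γ in P(∂)F) as an integer
  -- combination of the functionals P ↦ coefficient of x^δ in (M P)(∂)F, so that
  -- M P ∈ Ann(F) forces P ∈ Ann(F).
  InjectivityCertificate : ∀ {N} → Polynomial N → Polynomial N → ℕ → ℕ → DegreeCertificate → Set
  InjectivityCertificate {N} F M k r C = All (λ γ → All (λ α →
      suc (scale C) * D α γ + combine (negativeAt C γ) (E α) ≡ combine (positiveAt C γ) (E α))
    (monomials N k)) (monomials N r)
    where
    D E : Mon N → Mon N → ℕ
    D = contraction (exponents F)
    E = contractionBy (exponents M) (exponents F)

  mul-injective : ∀ {N s k r} {F M : Polynomial N} (C : DegreeCertificate) → CharZero K →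
    UnitCoefficients F → Homogeneous s F → UnitCoefficients M → r + k ≡ s →
    InjectivityCertificate F M k r C →
    ∀ P → Homogeneous k P → InAnn F (M ⊗ P) → InAnn F P
  mul-injective {N} {k = k} {r} {F} {M} C charZero unitF homF unitM r+k≡s certificate P homP MP∈Ann =
    InAnn-byDegree unitF homF homP λ γ γ+k≡s → ≈-trans (coeff-applyDiff P F γ unitF)
      (x≉0∧x*y≈0⇒y≈0 (charZero d) (scaled-vanishes γ
        (∈-monomials γ r (ℕₚ.+-cancelʳ-≡ k _ _ (trans γ+k≡s (sym r+k≡s))))))
    where
    d : ℕ
    d = scale C
    D E : Mon N → Mon N → ℕ
    D = contraction (exponents F)
    E = contractionBy (exponents M) (exponents F)
    E-vanishes : ∀ δ → pairing P (λ α → E α δ) ≈ 0#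
    E-vanishes δ = ≈-trans (≈-sym (coeff-applyDiff-⊗ M P F δ unitM unitF)) (MP∈Ann δ)
    scaled-vanishes : ∀ γ → γ ∈ monomials N r → fromℕ (suc d) *ᴷ pairing P (λ α → D α γ) ≈ 0#
    scaled-vanishes γ γ∈ = begin
      fromℕ (suc d) *ᴷ pairing P (λ α → D α γ)
        ≈⟨ pairing-scale P (suc d) (λ α → D α γ) ⟨
      pairing P (λ α → suc d * D α γ)
        ≈⟨ +-identityʳ _ ⟨
      pairing P (λ α → suc d * D α γ) +ᴷ 0#
        ≈⟨ +-congˡ (pairing-combine-vanishes P E (negativeAt C γ) E-vanishes) ⟨
      pairing P (λ α → suc d * D α γ) +ᴷ pairing P (λ α → combine (negativeAt C γ) (E α))
        ≈⟨ pairing-+ P (λ α → suc d * D α γ) (λ α → combine (negativeAt C γ) (E α)) ⟨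
      pairing P (λ α → suc d * D α γ + combine (negativeAt C γ) (E α))
        ≈⟨ pairing-cong P (All.map (λ {t} α-deg → All.lookup (All.lookup certificate γ∈)
                                                   (∈-monomials (proj₂ t) k α-deg)) homP) ⟩
      pairing P (λ α → combine (positiveAt C γ) (E α))
        ≈⟨ pairing-combine-vanishes P E (positiveAt C γ) E-vanishes ⟩
      0# ∎

  -- Row β is a form P_β of degree k with M P_β ≡ (1 + scale) x^β modulo Ann(F).
  SurjectivityCertificate : ∀ {N} → Polynomial N → Polynomial N → ℕ → ℕ → DegreeCertificate → Set
  SurjectivityCertificate {N} F M k r C =
    All (λ β → OfDegree (positiveAt C β) × OfDegree (negativeAt C β)) (monomials N r) ×
    All (λ β → All (λ γ → combine (positiveAt C β) (λ α → E α γ)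
                          ≡ suc (scale C) * D β γ + combine (negativeAt C β) (λ α → E α γ))
                   (monomials N k))
        (monomials N r)
    where
    D E : Mon N → Mon N → ℕ
    D = contraction (exponents F)
    E = contractionBy (exponents M) (exponents F)
    OfDegree : Combination N → Set
    OfDegree = All (λ e → deg (proj₂ e) ≡ k)

  scaled : ∀ {N} → Carrier → Combination N → Polynomial N
  scaled a = List.map (λ (x , δ) → a *ᴷ fromℕ x , δ)

  pairing-scaled : ∀ {N} a (X : Combination N) φ → pairing (scaled a X) φ ≈ a *ᴷ fromℕ (combine X φ)
  pairing-scaled a []            φ = ≈-sym (zeroʳ a)
  pairing-scaled a ((x , δ) ∷ X) φ = begin
    a *ᴷ fromℕ x *ᴷ fromℕ (φ δ) +ᴷ pairing (scaled a X) φ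
      ≈⟨ +-cong (*-assoc a _ _) (pairing-scaled a X φ) ⟩
    a *ᴷ (fromℕ x *ᴷ fromℕ (φ δ)) +ᴷ a *ᴷ fromℕ (combine X φ)
      ≈⟨ distribˡ a _ _ ⟨
    a *ᴷ (fromℕ x *ᴷ fromℕ (φ δ) +ᴷ fromℕ (combine X φ))
      ≈⟨ *-congˡ (≈-trans (fromℕ-+ (x * φ δ) _) (+-congʳ (fromℕ-* x (φ δ)))) ⟨
    a *ᴷ fromℕ (x * φ δ + combine X φ) ∎

  pairing-concatMap : ∀ {N} (f : Carrier × Mon N → Polynomial N) (Q : Polynomial N) φ ψ →
    All (λ t → pairing (f t) φ ≈ proj₁ t *ᴷ fromℕ (ψ (proj₂ t))) Q → pairing (concatMap f Q) φ ≈ pairing Q ψ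
  pairing-concatMap f []      φ ψ []       = ≈-refl
  pairing-concatMap f (t ∷ Q) φ ψ (e ∷ es) =
    ≈-trans (pairing-++ (f t) (concatMap f Q) φ) (+-cong e (pairing-concatMap f Q φ ψ es))

  cancel-scaled-difference : ∀ a y f x z → y *ᴷ f ≈ 1# →
                             (a *ᴷ y) *ᴷ (f *ᴷ x +ᴷ z) +ᴷ - ((a *ᴷ y) *ᴷ z) ≈ a *ᴷ x
  cancel-scaled-difference a y f x z y*f≈1 = begin
    (a *ᴷ y) *ᴷ (f *ᴷ x +ᴷ z) +ᴷ - ((a *ᴷ y) *ᴷ z)          ≈⟨ +-congʳ (distribˡ (a *ᴷ y) _ _) ⟩
    (a *ᴷ y) *ᴷ (f *ᴷ x) +ᴷ (a *ᴷ y) *ᴷ z +ᴷ - ((a *ᴷ y) *ᴷ z) ≈⟨ +-assoc _ _ _ ⟩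
    (a *ᴷ y) *ᴷ (f *ᴷ x) +ᴷ ((a *ᴷ y) *ᴷ z +ᴷ - ((a *ᴷ y) *ᴷ z)) ≈⟨ +-congˡ (-‿inverseʳ _) ⟩
    (a *ᴷ y) *ᴷ (f *ᴷ x) +ᴷ 0#                               ≈⟨ +-identityʳ _ ⟩
    (a *ᴷ y) *ᴷ (f *ᴷ x)                                     ≈⟨ *-assoc a y _ ⟩
    a *ᴷ (y *ᴷ (f *ᴷ x))                                     ≈⟨ *-congˡ (*-assoc y f x) ⟨
    a *ᴷ ((y *ᴷ f) *ᴷ x)                                     ≈⟨ *-congˡ (≈-trans (*-congʳ y*f≈1) (*-identityˡ x)) ⟩
    a *ᴷ x                                                   ∎

  mul-surjective : ∀ {N s j k r} {F M : Polynomial N} (C : DegreeCertificate) → CharZero K →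
    UnitCoefficients F → Homogeneous s F → UnitCoefficients M → Homogeneous j M → j + k ≡ r → r + k ≡ s →
    SurjectivityCertificate F M k r C →
    ∀ Q → Homogeneous r Q → ∃[ P ] (Homogeneous k P × InAnn F ((M ⊗ P) ⊖ Q))
  mul-surjective {N} {s} {j} {k} {r} {F} {M} C charZero unitF homF unitM homM j+k≡r r+k≡s
                 (degrees , identities) Q homQ =
    P , homP , InAnn-byDegree unitF homF homR annihilates
    where
    d : ℕ
    d = scale C
    D E : Mon N → Mon N → ℕ
    D = contraction (exponents F)
    E = contractionBy (exponents M) (exponents F)
    y : Carrier
    y = proj₁ (inverse (fromℕ (suc d)) (charZero d))
    y*f≈1 : y *ᴷ fromℕ (suc d) ≈ 1#
    y*f≈1 = ≈-trans (*-comm _ _) (proj₂ (inverse (fromℕ (suc d)) (charZero d)))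
    preimage : Carrier × Mon N → Polynomial N
    preimage (a , β) = scaled (a *ᴷ y) (positiveAt C β) ⊖ scaled (a *ᴷ y) (negativeAt C β)
    P : Polynomial N
    P = concatMap preimage Q
    β∈ : ∀ {t : Carrier × Mon N} → deg (proj₂ t) ≡ r → proj₂ t ∈ monomials N r
    β∈ {t} = ∈-monomials (proj₂ t) r
    homP : Homogeneous k P
    homP = concat⁺ (map⁺ (All.map (λ {t} β-deg → let (pos-deg , neg-deg) = All.lookup degrees (β∈ {t} β-deg)
                                                   in ++⁺ (map⁺ pos-deg) (map⁺ (map⁺ neg-deg))) homQ))
    homR : Homogeneous r ((M ⊗ P) ⊖ Q)
    homR = ++⁺ (subst (λ e → Homogeneous e (M ⊗ P)) j+k≡r (Homogeneous-⊗ homM homP)) (map⁺ homQ)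
    annihilates : ∀ γ → deg γ + r ≡ s → coeff (applyDiff ((M ⊗ P) ⊖ Q) F) γ ≈ 0#
    annihilates γ γ+r≡s = begin
      coeff (applyDiff ((M ⊗ P) ⊖ Q) F) γ        ≈⟨ coeff-applyDiff ((M ⊗ P) ⊖ Q) F γ unitF ⟩
      pairing ((M ⊗ P) ⊖ Q) Dγ                    ≈⟨ pairing-++ (M ⊗ P) (⊝ Q) Dγ ⟩
      pairing (M ⊗ P) Dγ +ᴷ pairing (⊝ Q) Dγ       ≈⟨ +-cong (pairing-⊗ M P Dγ unitM) (pairing-⊝ Q Dγ) ⟩
      pairing P Eγ +ᴷ - pairing Q Dγ               ≈⟨ +-congʳ (pairing-concatMap preimage Q Eγ Dγ
                                                        (All.map (λ {t} → preimage-pairing {t}) homQ)) ⟩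
      pairing Q Dγ +ᴷ - pairing Q Dγ               ≈⟨ -‿inverseʳ _ ⟩
      0#                                           ∎
      where
      Dγ Eγ : Mon N → ℕ
      Dγ β = D β γ
      Eγ α = E α γ
      γ∈ : γ ∈ monomials N k
      γ∈ = ∈-monomials γ k (ℕₚ.+-cancelʳ-≡ r _ _ (trans γ+r≡s (trans (sym r+k≡s) (ℕₚ.+-comm r k))))
      preimage-pairing : ∀ {t : Carrier × Mon N} → deg (proj₂ t) ≡ r →
                         pairing (preimage t) Eγ ≈ proj₁ t *ᴷ fromℕ (Dγ (proj₂ t))
      preimage-pairing {a , β} β-deg = begin
        pairing (scaled (a *ᴷ y) pos ++ ⊝ scaled (a *ᴷ y) neg) Eγ
          ≈⟨ pairing-++ (scaled (a *ᴷ y) pos) (⊝ scaled (a *ᴷ y) neg) Eγ ⟩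
        pairing (scaled (a *ᴷ y) pos) Eγ +ᴷ pairing (⊝ scaled (a *ᴷ y) neg) Eγ
          ≈⟨ +-cong (pairing-scaled (a *ᴷ y) pos Eγ)
                    (≈-trans (pairing-⊝ (scaled (a *ᴷ y) neg) Eγ) (-‿cong (pairing-scaled (a *ᴷ y) neg Eγ))) ⟩
        (a *ᴷ y) *ᴷ fromℕ (combine pos Eγ) +ᴷ - ((a *ᴷ y) *ᴷ fromℕ (combine neg Eγ))
          ≈⟨ +-congʳ (*-congˡ (≈-trans (reflexive (cong fromℕ row-identity))
               (≈-trans (fromℕ-+ (suc d * Dγ β) _) (+-congʳ (fromℕ-* (suc d) (Dγ β)))))) ⟩
        (a *ᴷ y) *ᴷ (fromℕ (suc d) *ᴷ fromℕ (Dγ β) +ᴷ fromℕ (combine neg Eγ))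
          +ᴷ - ((a *ᴷ y) *ᴷ fromℕ (combine neg Eγ))
          ≈⟨ cancel-scaled-difference a y _ _ _ y*f≈1 ⟩
        a *ᴷ fromℕ (Dγ β) ∎
        where
        pos neg : Combination N
        pos = positiveAt C β
        neg = negativeAt C β
        row-identity : combine pos Eγ ≡ suc d * Dγ β + combine neg Eγ
        row-identity = All.lookup (All.lookup identities (β∈ {a , β} β-deg)) γ∈

  topDegree : ∀ {N s} {F : Polynomial N} → CharZero K → UnitCoefficients F → Homogeneous s F →
    Any (λ β → contraction (exponents F) β (Vec.replicate N 0) ≢ 0) (exponents F) → TopDegree F s
  topDegree {N} {s} {F} charZero unitF homF witness = nonvanishing , vanishesAbove
    where
    vanishesAbove : ∀ k → s < k → PieceZero F k
    vanishesAbove k s<k P homP = InAnn-byDegree unitF homF homP λ γ γ+k≡s →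
      contradiction (ℕₚ.m+n≤o⇒n≤o (deg γ) (ℕₚ.≤-reflexive γ+k≡s)) (ℕₚ.<⇒≱ s<k)
    nonvanishing : ¬ PieceZero F s
    nonvanishing pieceZero with find witness
    ... | β , β∈ , n≢0 = fromℕ-nonzero charZero n≢0 (begin
      fromℕ n                                ≈⟨ *-identityˡ _ ⟨
      1# *ᴷ fromℕ n                          ≈⟨ +-identityʳ _ ⟨
      1# *ᴷ fromℕ n +ᴷ 0#                    ≈⟨ coeff-applyDiff x^β F 0⃗ unitF ⟨
      coeff (applyDiff x^β F) 0⃗              ≈⟨ pieceZero x^β (All.lookup (map⁺ homF) β∈ ∷ []) 0⃗ ⟩
      0#                                     ∎)
      where
      0⃗ : Mon N
      0⃗ = Vec.replicate N 0
      n : ℕ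
      n = contraction (exponents F) β 0⃗
      x^β : Polynomial N
      x^β = (1# , β) ∷ []

  Certified : ∀ {N} → Polynomial N → LefschetzCertificate → Set c
  Certified {N} F C =
    Homogeneous s F ×
    Any (λ β → contraction (exponents F) β (Vec.replicate N 0) ≢ 0) (exponents F) ×
    All (λ k → k + k ≤ s → InjectivityCertificate F (sumVars N ^ (s ∸ (k + k))) k (s ∸ k) (atDegree C k)
                         × SurjectivityCertificate F (sumVars N ^ (s ∸ (k + k))) k (s ∸ k) (atDegree C k))
        (upTo (suc s))
    where
    s : ℕ
    s = socleDegree C

  certified? : ∀ {N} (F : Polynomial N) C → Dec (Certified F C)
  certified? {N} F C =
    all? (λ t → deg (proj₂ t) ≟ s) F ×-dec
    any? (λ β → ¬? (contraction (exponents F) β (Vec.replicate N 0) ≟ 0)) (exponents F) ×-dec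
    all? (λ k → (k + k ≤? s) →-dec (injective? k ×-dec surjective? k)) (upTo (suc s))
    where
    s : ℕ
    s = socleDegree C
    M : ℕ → Polynomial N
    M k = sumVars N ^ (s ∸ (k + k))
    injective? : ∀ k → Dec (InjectivityCertificate F (M k) k (s ∸ k) (atDegree C k))
    injective? k = all? (λ γ → all? (λ α → _ ≟ _) _) _
    surjective? : ∀ k → Dec (SurjectivityCertificate F (M k) k (s ∸ k) (atDegree C k))
    surjective? k = all? (λ β → ofDegree? _ ×-dec ofDegree? _) _ ×-dec all? (λ β → all? (λ γ → _ ≟ _) _) _
      where
      ofDegree? : (X : Combination N) → Dec (All (λ e → deg (proj₂ e) ≡ k) X)
      ofDegree? = all? (λ e → deg (proj₂ e) ≟ k)

  certified⇒isStrongLefschetzElement : ∀ {N} {F : Polynomial N} (C : LefschetzCertificate) → CharZero K →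
    UnitCoefficients F → Certified F C → IsStrongLefschetzElement F (sumVars N)
  certified⇒isStrongLefschetzElement {N} {F} C charZero unitF (homF , witness , atDegrees) =
    Homogeneous-sumVars N , s , topDegree charZero unitF homF witness , bijective
    where
    s : ℕ
    s = socleDegree C
    k≤s : ∀ {k} → k + k ≤ s → k ≤ s
    k≤s {k} = ℕₚ.≤-trans (ℕₚ.m≤m+n k k)
    bijective : ∀ k → k + k ≤ s → MulBijective F (sumVars N ^ (s ∸ (k + k))) k (s ∸ k)
    bijective k k+k≤s with All.lookup atDegrees (∈-upTo⁺ (s≤s (k≤s {k} k+k≤s))) k+k≤s
    ... | injective , surjective =
      mul-injective (atDegree C k) charZero unitF homF unitM r+k≡s injective ,
      mul-surjective (atDegree C k) charZero unitF homF unitM (Homogeneous-sumVars^ N j) j+k≡r r+k≡s surjective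
      where
      j : ℕ
      j = s ∸ (k + k)
      unitM : UnitCoefficients (sumVars N ^ j)
      unitM = UnitCoefficients-sumVars^ N j
      r+k≡s : s ∸ k + k ≡ s
      r+k≡s = ℕₚ.m∸n+n≡m (k≤s {k} k+k≤s)
      j+k≡r : j + k ≡ s ∸ k
      j+k≡r = trans (cong (_+ k) (sym (ℕₚ.∸-+-assoc s k k)))
        (ℕₚ.m∸n+n≡m (subst (_≤ s ∸ k) (ℕₚ.m+n∸n≡m k k) (ℕₚ.∸-monoˡ-≤ k k+k≤s)))

  kirchhoff-strongLefschetz : CharZero K → ∀ G (C : LefschetzCertificate) → {True (certified? (kirchhoff G) C)} →
    HasStrongLefschetzProperty (kirchhoff G) × IsStrongLefschetzElement (kirchhoff G) (sumVars (Graph.E G))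
  kirchhoff-strongLefschetz charZero G C {valid} = (sumVars (Graph.E G) , sle) , sle
    where
    sle : IsStrongLefschetzElement (kirchhoff G) (sumVars (Graph.E G))
    sle = certified⇒isStrongLefschetzElement C charZero (UnitCoefficients-kirchhoff G) (toWitness valid)

certificate₁₁ : LefschetzCertificate
certificate₁₁ = record { socleDegree = 1 ; atDegree = degrees }
  where
  degrees : ℕ → DegreeCertificate
  degrees 0 = record { scale = 0 ; rows =
    row 1 ((1 , 0) ∷ []) [] ∷
    [] }
  degrees _ = record { scale = 0 ; rows = [] }

certificate₁₂ : LefschetzCertificate
certificate₁₂ = record { socleDegree = 2 ; atDegree = degrees }
  where
  degrees : ℕ → DegreeCertificate
  degrees 0 = record { scale = 1 ; rows =
    row 11 ((1 , 00) ∷ []) [] ∷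
    [] }
  degrees 1 = record { scale = 0 ; rows =
    row 10 ((1 , 10) ∷ []) [] ∷
    row 01 ((1 , 01) ∷ []) [] ∷
    [] }
  degrees _ = record { scale = 0 ; rows = [] }

certificate₁₃ : LefschetzCertificate
certificate₁₃ = record { socleDegree = 3 ; atDegree = degrees }
  where
  degrees : ℕ → DegreeCertificate
  degrees 0 = record { scale = 5 ; rows =
    row 111 ((1 , 000) ∷ []) [] ∷
    [] }
  degrees 1 = record { scale = 1 ; rows =
    row 110 ((1 , 100) ∷ (1 , 010) ∷ []) ((1 , 001) ∷ []) ∷
    row 101 ((1 , 100) ∷ (1 , 001) ∷ []) ((1 , 010) ∷ []) ∷
    row 011 ((1 , 010) ∷ (1 , 001) ∷ []) ((1 , 100) ∷ []) ∷
    [] }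
  degrees _ = record { scale = 0 ; rows = [] }

certificate₁₄ : LefschetzCertificate
certificate₁₄ = record { socleDegree = 4 ; atDegree = degrees }
  where
  degrees : ℕ → DegreeCertificate
  degrees 0 = record { scale = 23 ; rows =
    row 1111 ((1 , 0000) ∷ []) [] ∷
    [] }
  degrees 1 = record { scale = 5 ; rows =
    row 1110 ((1 , 1000) ∷ (1 , 0100) ∷ (1 , 0010) ∷ []) ((2 , 0001) ∷ []) ∷
    row 1101 ((1 , 1000) ∷ (1 , 0100) ∷ (1 , 0001) ∷ []) ((2 , 0010) ∷ []) ∷
    row 1011 ((1 , 1000) ∷ (1 , 0010) ∷ (1 , 0001) ∷ []) ((2 , 0100) ∷ []) ∷
    row 0111 ((1 , 0100) ∷ (1 , 0010) ∷ (1 , 0001) ∷ []) ((2 , 1000) ∷ []) ∷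
    [] }
  degrees 2 = record { scale = 0 ; rows =
    row 1100 ((1 , 1100) ∷ []) [] ∷
    row 1010 ((1 , 1010) ∷ []) [] ∷
    row 1001 ((1 , 1001) ∷ []) [] ∷
    row 0110 ((1 , 0110) ∷ []) [] ∷
    row 0101 ((1 , 0101) ∷ []) [] ∷
    row 0011 ((1 , 0011) ∷ []) [] ∷
    [] }
  degrees _ = record { scale = 0 ; rows = [] }

certificate₂₂ : LefschetzCertificate
certificate₂₂ = record { socleDegree = 3 ; atDegree = degrees }
  where
  degrees : ℕ → DegreeCertificate
  degrees 0 = record { scale = 23 ; rows =
    row 1110 ((1 , 0000) ∷ []) [] ∷
    row 1101 ((1 , 0000) ∷ []) [] ∷
    row 1011 ((1 , 0000) ∷ []) [] ∷
    row 0111 ((1 , 0000) ∷ []) [] ∷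
    [] }
  degrees 1 = record { scale = 5 ; rows =
    row 1100 ((2 , 1000) ∷ (2 , 0100) ∷ []) ((1 , 0010) ∷ (1 , 0001) ∷ []) ∷
    row 1010 ((2 , 1000) ∷ (2 , 0010) ∷ []) ((1 , 0100) ∷ (1 , 0001) ∷ []) ∷
    row 1001 ((2 , 1000) ∷ (2 , 0001) ∷ []) ((1 , 0100) ∷ (1 , 0010) ∷ []) ∷
    row 0110 ((2 , 0100) ∷ (2 , 0010) ∷ []) ((1 , 1000) ∷ (1 , 0001) ∷ []) ∷
    row 0101 ((2 , 0100) ∷ (2 , 0001) ∷ []) ((1 , 1000) ∷ (1 , 0010) ∷ []) ∷
    row 0011 ((2 , 0010) ∷ (2 , 0001) ∷ []) ((1 , 1000) ∷ (1 , 0100) ∷ []) ∷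
    [] }
  degrees _ = record { scale = 0 ; rows = [] }

certificate₂₃ : LefschetzCertificate
certificate₂₃ = record { socleDegree = 4 ; atDegree = degrees }
  where
  degrees : ℕ → DegreeCertificate
  degrees 0 = record { scale = 287 ; rows =
    row 111100 ((1 , 000000) ∷ []) [] ∷
    row 111010 ((1 , 000000) ∷ []) [] ∷
    row 111001 ((1 , 000000) ∷ []) [] ∷
    row 110101 ((1 , 000000) ∷ []) [] ∷
    row 110011 ((1 , 000000) ∷ []) [] ∷
    row 101110 ((1 , 000000) ∷ []) [] ∷
    row 101011 ((1 , 000000) ∷ []) [] ∷
    row 100111 ((1 , 000000) ∷ []) [] ∷
    row 011110 ((1 , 000000) ∷ []) [] ∷
    row 011101 ((1 , 000000) ∷ []) [] ∷
    row 010111 ((1 , 000000) ∷ []) [] ∷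
    row 001111 ((1 , 000000) ∷ []) [] ∷
    [] }
  degrees 1 = record { scale = 287 ; rows =
    row 111000 ((21 , 100000) ∷ (21 , 010000) ∷ (21 , 001000) ∷ []) ((15 , 000100) ∷ (15 , 000010) ∷ (15 , 000001) ∷ []) ∷
    row 110100 ((10 , 100000) ∷ (10 , 010000) ∷ (10 , 000100) ∷ (10 , 000010) ∷ []) ((14 , 001000) ∷ (14 , 000001) ∷ []) ∷
    row 110010 ((10 , 100000) ∷ (10 , 010000) ∷ (10 , 000100) ∷ (10 , 000010) ∷ []) ((14 , 001000) ∷ (14 , 000001) ∷ []) ∷
    row 110001 ((21 , 100000) ∷ (21 , 010000) ∷ (21 , 000001) ∷ []) ((15 , 001000) ∷ (15 , 000100) ∷ (15 , 000010) ∷ []) ∷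
    row 101100 ((10 , 100000) ∷ (10 , 001000) ∷ (10 , 000100) ∷ (10 , 000001) ∷ []) ((14 , 010000) ∷ (14 , 000010) ∷ []) ∷
    row 101010 ((21 , 100000) ∷ (21 , 001000) ∷ (21 , 000010) ∷ []) ((15 , 010000) ∷ (15 , 000100) ∷ (15 , 000001) ∷ []) ∷
    row 101001 ((10 , 100000) ∷ (10 , 001000) ∷ (10 , 000100) ∷ (10 , 000001) ∷ []) ((14 , 010000) ∷ (14 , 000010) ∷ []) ∷
    row 100110 ((10 , 100000) ∷ (10 , 010000) ∷ (10 , 000100) ∷ (10 , 000010) ∷ []) ((14 , 001000) ∷ (14 , 000001) ∷ []) ∷
    row 100101 ((10 , 100000) ∷ (10 , 001000) ∷ (10 , 000100) ∷ (10 , 000001) ∷ []) ((14 , 010000) ∷ (14 , 000010) ∷ []) ∷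
    row 100011 ((21 , 100000) ∷ (21 , 000010) ∷ (21 , 000001) ∷ []) ((15 , 010000) ∷ (15 , 001000) ∷ (15 , 000100) ∷ []) ∷
    row 011100 ((21 , 010000) ∷ (21 , 001000) ∷ (21 , 000100) ∷ []) ((15 , 100000) ∷ (15 , 000010) ∷ (15 , 000001) ∷ []) ∷
    row 011010 ((10 , 010000) ∷ (10 , 001000) ∷ (10 , 000010) ∷ (10 , 000001) ∷ []) ((14 , 100000) ∷ (14 , 000100) ∷ []) ∷
    row 011001 ((10 , 010000) ∷ (10 , 001000) ∷ (10 , 000010) ∷ (10 , 000001) ∷ []) ((14 , 100000) ∷ (14 , 000100) ∷ []) ∷
    row 010110 ((10 , 100000) ∷ (10 , 010000) ∷ (10 , 000100) ∷ (10 , 000010) ∷ []) ((14 , 001000) ∷ (14 , 000001) ∷ []) ∷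
    row 010101 ((21 , 010000) ∷ (21 , 000100) ∷ (21 , 000001) ∷ []) ((15 , 100000) ∷ (15 , 001000) ∷ (15 , 000010) ∷ []) ∷
    row 010011 ((10 , 010000) ∷ (10 , 001000) ∷ (10 , 000010) ∷ (10 , 000001) ∷ []) ((14 , 100000) ∷ (14 , 000100) ∷ []) ∷
    row 001110 ((21 , 001000) ∷ (21 , 000100) ∷ (21 , 000010) ∷ []) ((15 , 100000) ∷ (15 , 010000) ∷ (15 , 000001) ∷ []) ∷
    row 001101 ((10 , 100000) ∷ (10 , 001000) ∷ (10 , 000100) ∷ (10 , 000001) ∷ []) ((14 , 010000) ∷ (14 , 000010) ∷ []) ∷
    row 001011 ((10 , 010000) ∷ (10 , 001000) ∷ (10 , 000010) ∷ (10 , 000001) ∷ []) ((14 , 100000) ∷ (14 , 000100) ∷ []) ∷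
    row 000111 ((21 , 000100) ∷ (21 , 000010) ∷ (21 , 000001) ∷ []) ((15 , 100000) ∷ (15 , 010000) ∷ (15 , 001000) ∷ []) ∷
    [] }
  degrees 2 = record { scale = 0 ; rows =
    row 110000 ((1 , 110000) ∷ []) [] ∷
    row 101000 ((1 , 101000) ∷ []) [] ∷
    row 100100 ((1 , 100100) ∷ []) [] ∷
    row 100010 ((1 , 100010) ∷ []) [] ∷
    row 100001 ((1 , 100001) ∷ []) [] ∷
    row 011000 ((1 , 011000) ∷ []) [] ∷
    row 010100 ((1 , 010100) ∷ []) [] ∷
    row 010010 ((1 , 010010) ∷ []) [] ∷
    row 010001 ((1 , 010001) ∷ []) [] ∷
    row 001100 ((1 , 001100) ∷ []) [] ∷
    row 001010 ((1 , 001010) ∷ []) [] ∷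
    row 001001 ((1 , 001001) ∷ []) [] ∷
    row 000110 ((1 , 100010) ∷ (1 , 010100) ∷ []) ((1 , 110000) ∷ []) ∷
    row 000101 ((1 , 100001) ∷ (1 , 001100) ∷ []) ((1 , 101000) ∷ []) ∷
    row 000011 ((1 , 010001) ∷ (1 , 001010) ∷ []) ((1 , 011000) ∷ []) ∷
    [] }
  degrees _ = record { scale = 0 ; rows = [] }

certificate₃₂ : LefschetzCertificate
certificate₃₂ = record { socleDegree = 4 ; atDegree = degrees }
  where
  degrees : ℕ → DegreeCertificate
  degrees 0 = record { scale = 287 ; rows =
    row 111010 ((1 , 000000) ∷ []) [] ∷
    row 111001 ((1 , 000000) ∷ []) [] ∷
    row 110110 ((1 , 000000) ∷ []) [] ∷
    row 110101 ((1 , 000000) ∷ []) [] ∷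
    row 101110 ((1 , 000000) ∷ []) [] ∷
    row 101101 ((1 , 000000) ∷ []) [] ∷
    row 101011 ((1 , 000000) ∷ []) [] ∷
    row 100111 ((1 , 000000) ∷ []) [] ∷
    row 011110 ((1 , 000000) ∷ []) [] ∷
    row 011101 ((1 , 000000) ∷ []) [] ∷
    row 011011 ((1 , 000000) ∷ []) [] ∷
    row 010111 ((1 , 000000) ∷ []) [] ∷
    [] }
  degrees 1 = record { scale = 287 ; rows =
    row 111000 ((10 , 100000) ∷ (10 , 010000) ∷ (10 , 001000) ∷ (10 , 000100) ∷ []) ((14 , 000010) ∷ (14 , 000001) ∷ []) ∷
    row 110100 ((10 , 100000) ∷ (10 , 010000) ∷ (10 , 001000) ∷ (10 , 000100) ∷ []) ((14 , 000010) ∷ (14 , 000001) ∷ []) ∷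
    row 110010 ((10 , 100000) ∷ (10 , 010000) ∷ (10 , 000010) ∷ (10 , 000001) ∷ []) ((14 , 001000) ∷ (14 , 000100) ∷ []) ∷
    row 110001 ((10 , 100000) ∷ (10 , 010000) ∷ (10 , 000010) ∷ (10 , 000001) ∷ []) ((14 , 001000) ∷ (14 , 000100) ∷ []) ∷
    row 101100 ((10 , 100000) ∷ (10 , 010000) ∷ (10 , 001000) ∷ (10 , 000100) ∷ []) ((14 , 000010) ∷ (14 , 000001) ∷ []) ∷
    row 101010 ((21 , 100000) ∷ (21 , 001000) ∷ (21 , 000010) ∷ []) ((15 , 010000) ∷ (15 , 000100) ∷ (15 , 000001) ∷ []) ∷
    row 101001 ((21 , 100000) ∷ (21 , 001000) ∷ (21 , 000001) ∷ []) ((15 , 010000) ∷ (15 , 000100) ∷ (15 , 000010) ∷ []) ∷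
    row 100110 ((21 , 100000) ∷ (21 , 000100) ∷ (21 , 000010) ∷ []) ((15 , 010000) ∷ (15 , 001000) ∷ (15 , 000001) ∷ []) ∷
    row 100101 ((21 , 100000) ∷ (21 , 000100) ∷ (21 , 000001) ∷ []) ((15 , 010000) ∷ (15 , 001000) ∷ (15 , 000010) ∷ []) ∷
    row 100011 ((10 , 100000) ∷ (10 , 010000) ∷ (10 , 000010) ∷ (10 , 000001) ∷ []) ((14 , 001000) ∷ (14 , 000100) ∷ []) ∷
    row 011100 ((10 , 100000) ∷ (10 , 010000) ∷ (10 , 001000) ∷ (10 , 000100) ∷ []) ((14 , 000010) ∷ (14 , 000001) ∷ []) ∷
    row 011010 ((21 , 010000) ∷ (21 , 001000) ∷ (21 , 000010) ∷ []) ((15 , 100000) ∷ (15 , 000100) ∷ (15 , 000001) ∷ []) ∷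
    row 011001 ((21 , 010000) ∷ (21 , 001000) ∷ (21 , 000001) ∷ []) ((15 , 100000) ∷ (15 , 000100) ∷ (15 , 000010) ∷ []) ∷
    row 010110 ((21 , 010000) ∷ (21 , 000100) ∷ (21 , 000010) ∷ []) ((15 , 100000) ∷ (15 , 001000) ∷ (15 , 000001) ∷ []) ∷
    row 010101 ((21 , 010000) ∷ (21 , 000100) ∷ (21 , 000001) ∷ []) ((15 , 100000) ∷ (15 , 001000) ∷ (15 , 000010) ∷ []) ∷
    row 010011 ((10 , 100000) ∷ (10 , 010000) ∷ (10 , 000010) ∷ (10 , 000001) ∷ []) ((14 , 001000) ∷ (14 , 000100) ∷ []) ∷
    row 001110 ((10 , 001000) ∷ (10 , 000100) ∷ (10 , 000010) ∷ (10 , 000001) ∷ []) ((14 , 100000) ∷ (14 , 010000) ∷ []) ∷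
    row 001101 ((10 , 001000) ∷ (10 , 000100) ∷ (10 , 000010) ∷ (10 , 000001) ∷ []) ((14 , 100000) ∷ (14 , 010000) ∷ []) ∷
    row 001011 ((10 , 001000) ∷ (10 , 000100) ∷ (10 , 000010) ∷ (10 , 000001) ∷ []) ((14 , 100000) ∷ (14 , 010000) ∷ []) ∷
    row 000111 ((10 , 001000) ∷ (10 , 000100) ∷ (10 , 000010) ∷ (10 , 000001) ∷ []) ((14 , 100000) ∷ (14 , 010000) ∷ []) ∷
    [] }
  degrees 2 = record { scale = 0 ; rows =
    row 110000 ((1 , 110000) ∷ []) [] ∷
    row 101000 ((1 , 101000) ∷ []) [] ∷
    row 100100 ((1 , 100100) ∷ []) [] ∷
    row 100010 ((1 , 100010) ∷ []) [] ∷
    row 100001 ((1 , 100001) ∷ []) [] ∷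
    row 011000 ((1 , 011000) ∷ []) [] ∷
    row 010100 ((1 , 100100) ∷ (1 , 011000) ∷ []) ((1 , 101000) ∷ []) ∷
    row 010010 ((1 , 010010) ∷ []) [] ∷
    row 010001 ((1 , 100001) ∷ (1 , 010010) ∷ []) ((1 , 100010) ∷ []) ∷
    row 001100 ((1 , 001100) ∷ []) [] ∷
    row 001010 ((1 , 001010) ∷ []) [] ∷
    row 001001 ((1 , 001001) ∷ []) [] ∷
    row 000110 ((1 , 000110) ∷ []) [] ∷
    row 000101 ((1 , 001001) ∷ (1 , 000110) ∷ []) ((1 , 001010) ∷ []) ∷
    row 000011 ((1 , 000011) ∷ []) [] ∷
    [] }
  degrees _ = record { scale = 0 ; rows = [] }

theorem4p6 : ∀ {c ℓ} (K : Field c ℓ) → CharZero K →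
    (m n : ℕ) → 1 ≤ m → 1 ≤ n → m + n ≤ 5 →
    Poly.HasStrongLefschetzProperty K (Poly.kirchhoff K K[ m , n ])
    × Poly.IsStrongLefschetzElement K (Poly.kirchhoff K K[ m , n ]) (Poly.sumVars K (m * n))
theorem4p6 K charZero 1 1 _ _ _ = kirchhoff-strongLefschetz K charZero K[ 1 , 1 ] certificate₁₁
theorem4p6 K charZero 1 2 _ _ _ = kirchhoff-strongLefschetz K charZero K[ 1 , 2 ] certificate₁₂
theorem4p6 K charZero 1 3 _ _ _ = kirchhoff-strongLefschetz K charZero K[ 1 , 3 ] certificate₁₃
theorem4p6 K charZero 1 4 _ _ _ = kirchhoff-strongLefschetz K charZero K[ 1 , 4 ] certificate₁₄
theorem4p6 K charZero 2 2 _ _ _ = kirchhoff-strongLefschetz K charZero K[ 2 , 2 ] certificate₂₂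
theorem4p6 K charZero 2 3 _ _ _ = kirchhoff-strongLefschetz K charZero K[ 2 , 3 ] certificate₂₃
theorem4p6 K charZero 3 2 _ _ _ = kirchhoff-strongLefschetz K charZero K[ 3 , 2 ] certificate₃₂
-- K[ n , 1 ] and K[ 1 , n ] have the same Kirchhoff polynomial x₀ ⋯ x_(n-1).
theorem4p6 K charZero 2 1 _ _ _ = kirchhoff-strongLefschetz K charZero K[ 2 , 1 ] certificate₁₂
theorem4p6 K charZero 3 1 _ _ _ = kirchhoff-strongLefschetz K charZero K[ 3 , 1 ] certificate₁₃
theorem4p6 K charZero 4 1 _ _ _ = kirchhoff-strongLefschetz K charZero K[ 4 , 1 ] certificate₁₄
theorem4p6 K charZero 0 _ () _ _
theorem4p6 K charZero (suc _) 0 _ () _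
theorem4p6 K charZero 1 (suc (suc (suc (suc (suc _))))) _ _ (s≤s (s≤s (s≤s (s≤s (s≤s ())))))
theorem4p6 K charZero 2 (suc (suc (suc (suc _)))) _ _ (s≤s (s≤s (s≤s (s≤s (s≤s ())))))
theorem4p6 K charZero 3 (suc (suc (suc _))) _ _ (s≤s (s≤s (s≤s (s≤s (s≤s ())))))
theorem4p6 K charZero 4 (suc (suc _)) _ _ (s≤s (s≤s (s≤s (s≤s (s≤s ())))))
theorem4p6 K charZero (suc (suc (suc (suc (suc m))))) (suc n) _ _ (s≤s (s≤s (s≤s (s≤s (s≤s m+1+n≤0))))) =
  contradiction (ℕₚ.≤-trans (ℕₚ.m≤n+m (suc n) m) m+1+n≤0) λ ()
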